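{- Let $G$ be a group, let $n_i,n_j$ be positive integers, and let $A\in M_{2n_i,2n_j}(\mathbb{C}G)$ be a block matrix $$A=\begin{pmatrix} A_{1,1} & A_{1,2}\\ A_{2,1} & A_{2,2}\end{pmatrix}$$ with each block of size $n_i\times n_j$. Suppose that the blocks $A_{1,1}$ and $A_{2,2}$ both have constant row sum, equal to the same element $r_1\in\mathbb{C}G$, and both have constant column sum, equal to the same element $c_1\in\mathbb{C}G$; and suppose likewise that $A_{1,2}$ and $A_{2,1}$ both have constant row sum equal to the same element $r_2\in\mathbb{C}G$ and constant column sum equal to the same element $c_2\in\mathbb{C}G$. Then $Q_{n_i}AQ_{n_j}=A$.
   Context: $\mathbb{C}G$ denotes the complex group algebra of $G$, with neutral element $1_G$; $M_{n,m}(\mathbb{C}G)$ is the set of $n\times m$ matrices with entries in $\mathbb{C}G$, and $M_n(\mathbb{C}G)=M_{n,n}(\mathbb{C}G)$. $I_{M_m(\mathbb{C}G)}$ is the $m\times m$ identity matrix (diagonal entries $1_G$) and $J_{M_m(\mathbb{C}G)}$ is the $m\times m$ matrix all of whose entries are $1_G$. For a positive integer $m$, $$Q_m=\begin{pmatrix} I_{M_m(\mathbb{C}G)}-\frac1m J_{M_m(\mathbb{C}G)} & \frac1m J_{M_m(\mathbb{C}G)}\\ \frac1m J_{M_m(\mathbb{C}G)} & I_{M_m(\mathbb{C}G)}-\frac1m J_{M_m(\mathbb{C}G)}\end{pmatrix}\in M_{2m}(\mathbb{C}G).$$ -}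

module Defs where

open import Level using (_⊔_)
open import Algebra.Bundles using (Ring)
open import Data.Nat using (ℕ; zero; suc) renaming (_+_ to _+ℕ_)
open import Data.Fin using (Fin; zero; suc; splitAt; _↑ˡ_; _↑ʳ_)
open import Data.Fin.Properties using (_≟_)
open import Data.Sum using (inj₁; inj₂)
open import Data.Product using (_×_)
open import Relation.Nullary using (yes; no)

-- The ring R plays the role of the group algebra ℂG.
module _ {c ℓ} (R : Ring c ℓ) where
  open Ring R using (Carrier; _≈_; _+_; _*_; -_; _-_; 0#; 1#)

  Mat : ℕ → ℕ → Set c
  Mat n m = Fin n → Fin m → Carrier

  ΣF : ∀ n → (Fin n → Carrier) → Carrier
  ΣF zero    f = 0#
  ΣF (suc n) f = f zero + ΣF n (λ k → f (suc k))

  _⊗_ : ∀ {n m p} → Mat n m → Mat m p → Mat n p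
  (A ⊗ B) i j = ΣF _ (λ k → A i k * B k j)

  natR : ℕ → Carrier
  natR zero    = 0#
  natR (suc m) = 1# + natR m

  -- u is a (two-sided, central) inverse of m·1 in R;
  -- in ℂG this is the element (1/m)·1_G
  IsCentralInv : ℕ → Carrier → Set (c ⊔ ℓ)
  IsCentralInv m u = ((natR m * u) ≈ 1#) × ((u * natR m) ≈ 1#) × (∀ x → (u * x) ≈ (x * u))

  Id : ∀ m → Mat m m
  Id m i j with i ≟ j
  ... | yes _ = 1#
  ... | no  _ = 0#

  -- Q_m = [[I - (1/m)J , (1/m)J] , [(1/m)J , I - (1/m)J]], where u = 1/m
  Q : ∀ m → Carrier → Mat (m +ℕ m) (m +ℕ m)
  Q m u i j with splitAt m i | splitAt m j
  ... | inj₁ a | inj₁ b = Id m a b - u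
  ... | inj₂ a | inj₂ b = Id m a b - u
  ... | inj₁ _ | inj₂ _ = u
  ... | inj₂ _ | inj₁ _ = u

  blk₁₁ blk₁₂ blk₂₁ blk₂₂ : ∀ n m → Mat (n +ℕ n) (m +ℕ m) → Mat n m
  blk₁₁ n m A i j = A (i ↑ˡ n) (j ↑ˡ m)
  blk₁₂ n m A i j = A (i ↑ˡ n) (m ↑ʳ j)
  blk₂₁ n m A i j = A (n ↑ʳ i) (j ↑ˡ m)
  blk₂₂ n m A i j = A (n ↑ʳ i) (m ↑ʳ j)

  RowSum : ∀ {n m} → Mat n m → Carrier → Set ℓ
  RowSum {n} {m} B r = ∀ i → ΣF m (λ j → B i j) ≈ r

  ColSum : ∀ {n m} → Mat n m → Carrier → Set ℓ
  ColSum {n} {m} B s = ∀ j → ΣF n (λ i → B i j) ≈ s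

-- Let s = (1,…,1,−1,…,−1) be the sign vector of the two halves. Then Q_m = I − u s sᵀ with u = 1/m.
-- The block hypotheses say precisely that sᵀA = κ tᵀ and A t = s ρ, where κ = c₁ − c₂, ρ = r₁ − r₂ and
-- t is the sign vector on the column side, so both corrections in Q A Q are multiples of s tᵀ:
-- Q A Q = A − s (u κ) tᵀ − s ((ρ − u κ · tᵀt) u′) tᵀ. Double counting the entries of one block gives
-- n_i ρ = n_j κ, hence ρ u′ = u κ, and tᵀt = 2 n_j gives (tᵀt) u′ = 2, so the two corrections cancel.
module Submission where

open import Defs
open import Algebra.Bundles using (Ring)
open import Data.Nat using (ℕ; _≤_; zero; suc) renaming (_+_ to _+ℕ_)
open import Data.Fin using (Fin; zero; suc; splitAt; _↑ˡ_; _↑ʳ_)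
open import Data.Fin.Properties using (_≟_; splitAt-↑ˡ; splitAt-↑ʳ; suc-injective; ↑ˡ-injective; ↑ʳ-injective)
open import Data.Product using (_,_)
open import Data.Sum using ([_,_]′)
open import Function using (const; _∘_)
open import Relation.Nullary using (yes; no; contradiction)
open import Relation.Binary.PropositionalEquality as ≡ using (_≡_; _≢_)
import Algebra.Properties.Ring as RingProperties
import Algebra.Properties.Semiring.Mult as SemiringMult
import Algebra.Properties.Semiring.Sum as SemiringSum
import Relation.Binary.Reasoning.Setoid as SetoidReasoning

module _ {c ℓ} (R : Ring c ℓ) where
  open Ring R hiding (zero)
  open RingProperties R using (-0#≈0#; -‿involutive; -1*x≈-x; -‿distribˡ-*; -‿distribʳ-*; [y-z]x≈yx-zx; x[y-z]≈xy-xz; -‿+-comm; ⁻¹-anti-homo‿-)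
  open SemiringMult semiring using (_×_; ×-congʳ; ×-homo-+; ×-assoc-*; ×-comm-*)
  open SemiringSum semiring using (sum; sum-syntax; sum-cong-≋; sum-replicate; sum-replicate-zero; ∑-distrib-+; ∑-comm; *-distribˡ-sum; *-distribʳ-sum)
  open SetoidReasoning setoid

  x*-1≈-x : ∀ x → x * - 1# ≈ - x
  x*-1≈-x x = trans (sym (-‿distribʳ-* x 1#)) (-‿cong (*-identityʳ x))

  natR≡×1# : ∀ n → natR R n ≡ n × 1#
  natR≡×1# zero    = ≡.refl
  natR≡×1# (suc n) = ≡.cong (1# +_) (natR≡×1# n)

  natR-+ : ∀ m n → natR R (m +ℕ n) ≈ natR R m + natR R n
  natR-+ m n = begin
    natR R (m +ℕ n)     ≡⟨ natR≡×1# (m +ℕ n) ⟩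
    (m +ℕ n) × 1#       ≈⟨ ×-homo-+ 1# m n ⟩
    m × 1# + n × 1#     ≡⟨ ≡.cong₂ _+_ (natR≡×1# m) (natR≡×1# n) ⟨
    natR R m + natR R n ∎

  natR-*-to-× : ∀ n x → natR R n * x ≈ n × x
  natR-*-to-× n x = begin
    natR R n * x ≡⟨ ≡.cong (_* x) (natR≡×1# n) ⟩
    n × 1# * x   ≈⟨ ×-assoc-* n 1# x ⟩
    n × (1# * x) ≈⟨ ×-congʳ n (*-identityˡ x) ⟩
    n × x        ∎

  natR-central : ∀ n x → natR R n * x ≈ x * natR R n
  natR-central n x = begin
    natR R n * x    ≈⟨ natR-*-to-× n x ⟩
    n × x           ≈⟨ ×-congʳ n (*-identityʳ x) ⟨
    n × (x * 1#)    ≈⟨ ×-comm-* n x 1# ⟨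
    x * (n × 1#)    ≡⟨ ≡.cong (x *_) (natR≡×1# n) ⟨
    x * natR R n    ∎

  ΣF≡sum : ∀ n (f : Fin n → Carrier) → ΣF R n f ≡ sum f
  ΣF≡sum zero    f = ≡.refl
  ΣF≡sum (suc n) f = ≡.cong (f zero +_) (ΣF≡sum n (f ∘ suc))

  sum-cong : ∀ n {f g : Fin n → Carrier} → (∀ k → f k ≈ g k) → sum f ≈ sum g
  sum-cong n = sum-cong-≋

  sum-const : ∀ n x → ∑[ k < n ] x ≈ natR R n * x
  sum-const n x = trans (sum-replicate n) (sym (natR-*-to-× n x))

  -‿distrib-sum : ∀ {n} (f : Fin n → Carrier) → - sum f ≈ ∑[ k < n ] (- f k)
  -‿distrib-sum {zero}  f = -0#≈0#
  -‿distrib-sum {suc n} f = trans (sym (-‿+-comm (f zero) _)) (+-congˡ (-‿distrib-sum (f ∘ suc)))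

  ∑-distrib-- : ∀ n (f g : Fin n → Carrier) → ∑[ k < n ] (f k - g k) ≈ sum f - sum g
  ∑-distrib-- n f g = trans (∑-distrib-+ {n} f (λ k → - g k)) (+-congˡ (sym (-‿distrib-sum g)))

  sum-↑ˡ-↑ʳ : ∀ m n (f : Fin (m +ℕ n) → Carrier) → sum f ≈ sum (f ∘ (_↑ˡ n)) + sum (f ∘ (m ↑ʳ_))
  sum-↑ˡ-↑ʳ zero    n f = sym (+-identityˡ _)
  sum-↑ˡ-↑ʳ (suc m) n f = trans (+-congˡ (sum-↑ˡ-↑ʳ m n (f ∘ suc))) (sym (+-assoc _ _ _))

  Id-diagonal : ∀ {n} (i : Fin n) → Id R n i i ≡ 1#
  Id-diagonal i with i ≟ i
  ... | yes _  = ≡.refl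
  ... | no i≢i = contradiction ≡.refl i≢i

  Id-offDiagonal : ∀ {n} {i j : Fin n} → i ≢ j → Id R n i j ≡ 0#
  Id-offDiagonal {i = i} {j} i≢j with i ≟ j
  ... | yes i≡j = contradiction i≡j i≢j
  ... | no _    = ≡.refl

  Id-injective : ∀ {m n} (f : Fin m → Fin n) → (∀ {a b} → f a ≡ f b → a ≡ b) →
                 ∀ a b → Id R n (f a) (f b) ≡ Id R m a b
  Id-injective f f-inj a b with a ≟ b
  ... | yes ≡.refl = Id-diagonal (f a)
  ... | no a≢b     = Id-offDiagonal (a≢b ∘ f-inj)

  sum-Idˡ : ∀ {n} i (v : Fin n → Carrier) → ∑[ k < n ] (Id R n i k * v k) ≈ v i
  sum-Idˡ {suc n} zero v = begin
    Id R (suc n) zero zero * v zero + ∑[ k < n ] (Id R (suc n) zero (suc k) * v (suc k))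
      ≈⟨ +-cong (*-congʳ (reflexive (Id-diagonal {suc n} zero)))
                (sum-cong n λ k → trans (*-congʳ (reflexive (Id-offDiagonal {i = zero} {suc k} λ ()))) (zeroˡ _)) ⟩
    1# * v zero + ∑[ k < n ] 0#  ≈⟨ +-cong (*-identityˡ _) (sum-replicate-zero n) ⟩
    v zero + 0#                  ≈⟨ +-identityʳ _ ⟩
    v zero                       ∎
  sum-Idˡ {suc n} (suc i) v = begin
    Id R (suc n) (suc i) zero * v zero + ∑[ k < n ] (Id R (suc n) (suc i) (suc k) * v (suc k))
      ≈⟨ +-cong (trans (*-congʳ (reflexive (Id-offDiagonal {i = suc i} {zero} λ ()))) (zeroˡ _))
                (sum-cong n λ k → *-congʳ (reflexive (Id-injective suc suc-injective i k))) ⟩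
    0# + ∑[ k < n ] (Id R n i k * v (suc k)) ≈⟨ +-identityˡ _ ⟩
    ∑[ k < n ] (Id R n i k * v (suc k))      ≈⟨ sum-Idˡ i (v ∘ suc) ⟩
    v (suc i)                                ∎

  sum-Idʳ : ∀ {n} j (w : Fin n → Carrier) → ∑[ k < n ] (w k * Id R n k j) ≈ w j
  sum-Idʳ {suc n} zero w = begin
    w zero * Id R (suc n) zero zero + ∑[ k < n ] (w (suc k) * Id R (suc n) (suc k) zero)
      ≈⟨ +-cong (*-congˡ (reflexive (Id-diagonal {suc n} zero)))
                (sum-cong n λ k → trans (*-congˡ (reflexive (Id-offDiagonal {i = suc k} {zero} λ ()))) (zeroʳ _)) ⟩
    w zero * 1# + ∑[ k < n ] 0#  ≈⟨ +-cong (*-identityʳ _) (sum-replicate-zero n) ⟩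
    w zero + 0#                  ≈⟨ +-identityʳ _ ⟩
    w zero                       ∎
  sum-Idʳ {suc n} (suc j) w = begin
    w zero * Id R (suc n) zero (suc j) + ∑[ k < n ] (w (suc k) * Id R (suc n) (suc k) (suc j))
      ≈⟨ +-cong (trans (*-congˡ (reflexive (Id-offDiagonal {i = zero} {suc j} λ ()))) (zeroʳ _))
                (sum-cong n λ k → *-congˡ (reflexive (Id-injective suc suc-injective k j))) ⟩
    0# + ∑[ k < n ] (w (suc k) * Id R n k j) ≈⟨ +-identityˡ _ ⟩
    ∑[ k < n ] (w (suc k) * Id R n k j)      ≈⟨ sum-Idʳ j (w ∘ suc) ⟩
    w (suc j)                                ∎

  _·ᵥ_ : ∀ {n m} → Mat R n m → (Fin m → Carrier) → Fin n → Carrier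
  (A ·ᵥ t) i = ∑[ k < _ ] (A i k * t k)

  _ᵥ·_ : ∀ {n m} → (Fin n → Carrier) → Mat R n m → Fin m → Carrier
  (s ᵥ· A) j = ∑[ k < _ ] (s k * A k j)

  outer : ∀ {n m} → (Fin n → Carrier) → Carrier → (Fin m → Carrier) → Mat R n m
  outer s a t i j = s i * (a * t j)

  householder : ∀ n → Carrier → (Fin n → Carrier) → Mat R n n
  householder n u s i j = Id R n i j - outer s u s i j

  ⊗≡sum : ∀ {n m p} (A : Mat R n m) (B : Mat R m p) i j → _⊗_ R A B i j ≡ ∑[ k < m ] (A i k * B k j)
  ⊗≡sum {m = m} A B i j = ΣF≡sum m (λ k → A i k * B k j)

  ⊗-cong : ∀ {n m p} {A A′ : Mat R n m} {B B′ : Mat R m p} →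
           (∀ i k → A i k ≈ A′ i k) → (∀ k j → B k j ≈ B′ k j) →
           ∀ i j → _⊗_ R A B i j ≈ _⊗_ R A′ B′ i j
  ⊗-cong {m = m} {A = A} {A′} {B} {B′} A≈A′ B≈B′ i j = begin
    _⊗_ R A B i j                ≡⟨ ⊗≡sum A B i j ⟩
    ∑[ k < _ ] (A i k * B k j)   ≈⟨ sum-cong m (λ k → *-cong (A≈A′ i k) (B≈B′ k j)) ⟩
    ∑[ k < _ ] (A′ i k * B′ k j) ≡⟨ ⊗≡sum A′ B′ i j ⟨
    _⊗_ R A′ B′ i j              ∎

  householder-⊗ˡ : ∀ {n m} u s (A : Mat R n m) i j →
                   _⊗_ R (householder n u s) A i j ≈ A i j - s i * (u * (s ᵥ· A) j)
  householder-⊗ˡ {n} u s A i j = begin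
    _⊗_ R (householder n u s) A i j
      ≡⟨ ⊗≡sum (householder n u s) A i j ⟩
    ∑[ k < n ] ((Id R n i k - outer s u s i k) * A k j)
      ≈⟨ sum-cong n (λ k → [y-z]x≈yx-zx (A k j) (Id R n i k) _) ⟩
    ∑[ k < n ] (Id R n i k * A k j - outer s u s i k * A k j)
      ≈⟨ ∑-distrib-- n _ _ ⟩
    ∑[ k < n ] (Id R n i k * A k j) - ∑[ k < n ] (s i * (u * s k) * A k j)
      ≈⟨ +-cong (sum-Idˡ i (λ k → A k j))
                (-‿cong (sum-cong n λ k → trans (*-assoc _ _ _) (*-congˡ (*-assoc _ _ _)))) ⟩
    A i j - ∑[ k < n ] (s i * (u * (s k * A k j)))
      ≈⟨ +-congˡ (-‿cong (trans (sym (*-distribˡ-sum {n} (s i) _)) (*-congˡ (sym (*-distribˡ-sum {n} u _))))) ⟩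
    A i j - s i * (u * (s ᵥ· A) j) ∎

  ⊗-householderʳ : ∀ {n m} u t (A : Mat R n m) i j →
                   _⊗_ R A (householder m u t) i j ≈ A i j - ((A ·ᵥ t) i * u) * t j
  ⊗-householderʳ {m = m} u t A i j = begin
    _⊗_ R A (householder m u t) i j
      ≡⟨ ⊗≡sum A (householder m u t) i j ⟩
    ∑[ k < m ] (A i k * (Id R m k j - outer t u t k j))
      ≈⟨ sum-cong m (λ k → x[y-z]≈xy-xz (A i k) (Id R m k j) _) ⟩
    ∑[ k < m ] (A i k * Id R m k j - A i k * outer t u t k j)
      ≈⟨ ∑-distrib-- m _ _ ⟩
    ∑[ k < m ] (A i k * Id R m k j) - ∑[ k < m ] (A i k * (t k * (u * t j)))
      ≈⟨ +-cong (sum-Idʳ j (A i))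
                (-‿cong (sum-cong m λ k → trans (sym (*-assoc _ _ _)) (sym (*-assoc _ _ _)))) ⟩
    A i j - ∑[ k < m ] (A i k * t k * u * t j)
      ≈⟨ +-congˡ (-‿cong (trans (sym (*-distribʳ-sum {m} (t j) _)) (*-congʳ (sym (*-distribʳ-sum {m} u _))))) ⟩
    A i j - ((A ·ᵥ t) i * u) * t j ∎

  module _ {n m} (A : Mat R n m) (s : Fin n → Carrier) (t : Fin m → Carrier) where

    householder-⊗-balanced : ∀ u κ → (∀ j → (s ᵥ· A) j ≈ κ * t j) →
                             ∀ i j → _⊗_ R (householder n u s) A i j ≈ A i j - outer s (u * κ) t i j
    householder-⊗-balanced u κ sA≈κt i j = trans (householder-⊗ˡ u s A i j)
      (+-congˡ (-‿cong (*-congˡ (trans (*-congˡ (sA≈κt j)) (sym (*-assoc u κ (t j)))))))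

    ⊗-householder-balanced : ∀ u ρ → (∀ i → (A ·ᵥ t) i ≈ s i * ρ) →
                             ∀ i j → _⊗_ R A (householder m u t) i j ≈ A i j - outer s (ρ * u) t i j
    ⊗-householder-balanced u ρ At≈sρ i j = trans (⊗-householderʳ u t A i j)
      (+-congˡ (-‿cong (begin
        (A ·ᵥ t) i * u * t j ≈⟨ *-congʳ (*-congʳ (At≈sρ i)) ⟩
        s i * ρ * u * t j    ≈⟨ *-congʳ (*-assoc (s i) ρ u) ⟩
        s i * (ρ * u) * t j  ≈⟨ *-assoc (s i) (ρ * u) (t j) ⟩
        outer s (ρ * u) t i j ∎)))

    -‿outer-balanced : ∀ ρ x → (∀ i → (A ·ᵥ t) i ≈ s i * ρ) →
                        ∀ i → ((λ i k → A i k - outer s x t i k) ·ᵥ t) i ≈ s i * (ρ - x * ∑[ k < m ] (t k * t k))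
    -‿outer-balanced ρ x At≈sρ i = begin
      ∑[ k < m ] ((A i k - outer s x t i k) * t k)
        ≈⟨ sum-cong m (λ k → [y-z]x≈yx-zx (t k) (A i k) _) ⟩
      ∑[ k < m ] (A i k * t k - outer s x t i k * t k)
        ≈⟨ ∑-distrib-- m _ _ ⟩
      (A ·ᵥ t) i - ∑[ k < m ] (s i * (x * t k) * t k)
        ≈⟨ +-cong (At≈sρ i) (-‿cong (sum-cong m λ k → trans (*-assoc _ _ _) (*-congˡ (*-assoc _ _ _)))) ⟩
      s i * ρ - ∑[ k < m ] (s i * (x * (t k * t k)))
        ≈⟨ +-congˡ (-‿cong (trans (sym (*-distribˡ-sum {m} (s i) _)) (*-congˡ (sym (*-distribˡ-sum {m} x _))))) ⟩
      s i * ρ - s i * (x * ∑[ k < m ] (t k * t k))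
        ≈⟨ x[y-z]≈xy-xz (s i) ρ _ ⟨
      s i * (ρ - x * ∑[ k < m ] (t k * t k)) ∎

  householder-sandwich : ∀ {n m} (A : Mat R n m) s t u u′ κ ρ →
    (∀ j → (s ᵥ· A) j ≈ κ * t j) → (∀ i → (A ·ᵥ t) i ≈ s i * ρ) →
    ∀ i j → _⊗_ R (_⊗_ R (householder n u s) A) (householder m u′ t) i j
            ≈ A i j - outer s (u * κ) t i j - outer s ((ρ - u * κ * ∑[ k < m ] (t k * t k)) * u′) t i j
  householder-sandwich {m = m} A s t u u′ κ ρ sA≈κt At≈sρ i j = trans
    (⊗-cong {B = householder m u′ t} (householder-⊗-balanced A s t u κ sA≈κt) (λ _ _ → refl) i j)
    (⊗-householder-balanced (λ i k → A i k - outer s (u * κ) t i k) s t u′ _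
      (-‿outer-balanced A s t ρ (u * κ) At≈sρ) i j)

  data Side (m n : ℕ) : Fin (m +ℕ n) → Set where
    left  : ∀ a → Side m n (a ↑ˡ n)
    right : ∀ b → Side m n (m ↑ʳ b)

  side : ∀ m {n} i → Side m n i
  side zero    i       = right i
  side (suc m) zero    = left zero
  side (suc m) (suc i) with side m i
  ... | left a  = left (suc a)
  ... | right b = right b

  ↑ˡ≢↑ʳ : ∀ {m n} (a : Fin m) (b : Fin n) → a ↑ˡ n ≢ m ↑ʳ b
  ↑ˡ≢↑ʳ {m} {n} a b eq with ≡.trans (≡.sym (splitAt-↑ˡ m a n)) (≡.trans (≡.cong (splitAt m) eq) (splitAt-↑ʳ m n b))
  ... | ()

  sign : ∀ m {n} → Fin (m +ℕ n) → Carrier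
  sign m i = [ const 1# , const (- 1#) ]′ (splitAt m i)

  sign-↑ˡ : ∀ m {n} (a : Fin m) → sign m {n} (a ↑ˡ n) ≡ 1#
  sign-↑ˡ m {n} a = ≡.cong [ const 1# , const (- 1#) ]′ (splitAt-↑ˡ m a n)

  sign-↑ʳ : ∀ m {n} (b : Fin n) → sign m (m ↑ʳ b) ≡ - 1#
  sign-↑ʳ m {n} b = ≡.cong [ const 1# , const (- 1#) ]′ (splitAt-↑ʳ m n b)

  sign-*-sign : ∀ m {n} (k : Fin (m +ℕ n)) → sign m k * sign m k ≈ 1#
  sign-*-sign m k with side m k
  ... | left a  = trans (*-cong (reflexive (sign-↑ˡ m a)) (reflexive (sign-↑ˡ m a))) (*-identityˡ 1#)
  ... | right b = trans (*-cong (reflexive (sign-↑ʳ m b)) (reflexive (sign-↑ʳ m b)))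
                        (trans (-1*x≈-x (- 1#)) (-‿involutive 1#))

  sum-sign-* : ∀ m n (v : Fin (m +ℕ n) → Carrier) →
               ∑[ k < m +ℕ n ] (sign m k * v k) ≈ sum (v ∘ (_↑ˡ n)) - sum (v ∘ (m ↑ʳ_))
  sum-sign-* m n v = begin
    ∑[ k < m +ℕ n ] (sign m k * v k)
      ≈⟨ sum-↑ˡ-↑ʳ m n _ ⟩
    ∑[ a < m ] (sign m (a ↑ˡ n) * v (a ↑ˡ n)) + ∑[ b < n ] (sign m (m ↑ʳ b) * v (m ↑ʳ b))
      ≈⟨ +-cong (sum-cong m λ a → trans (*-congʳ (reflexive (sign-↑ˡ m a))) (*-identityˡ _))
                (sum-cong n λ b → trans (*-congʳ (reflexive (sign-↑ʳ m b))) (-1*x≈-x _)) ⟩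
    sum (v ∘ (_↑ˡ n)) + ∑[ b < n ] (- v (m ↑ʳ b))
      ≈⟨ +-congˡ (-‿distrib-sum (v ∘ (m ↑ʳ_))) ⟨
    sum (v ∘ (_↑ˡ n)) - sum (v ∘ (m ↑ʳ_)) ∎

  sum-*-sign : ∀ m n (v : Fin (m +ℕ n) → Carrier) →
               ∑[ k < m +ℕ n ] (v k * sign m k) ≈ sum (v ∘ (_↑ˡ n)) - sum (v ∘ (m ↑ʳ_))
  sum-*-sign m n v = begin
    ∑[ k < m +ℕ n ] (v k * sign m k)
      ≈⟨ sum-↑ˡ-↑ʳ m n _ ⟩
    ∑[ a < m ] (v (a ↑ˡ n) * sign m (a ↑ˡ n)) + ∑[ b < n ] (v (m ↑ʳ b) * sign m (m ↑ʳ b))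
      ≈⟨ +-cong (sum-cong m λ a → trans (*-congˡ (reflexive (sign-↑ˡ m a))) (*-identityʳ _))
                (sum-cong n λ b → trans (*-congˡ (reflexive (sign-↑ʳ m b))) (x*-1≈-x _)) ⟩
    sum (v ∘ (_↑ˡ n)) + ∑[ b < n ] (- v (m ↑ʳ b))
      ≈⟨ +-congˡ (-‿distrib-sum (v ∘ (m ↑ʳ_))) ⟨
    sum (v ∘ (_↑ˡ n)) - sum (v ∘ (m ↑ʳ_)) ∎

  sum-sign-*-sign : ∀ m n → ∑[ k < m +ℕ n ] (sign m k * sign m k) ≈ natR R (m +ℕ n)
  sum-sign-*-sign m n = begin
    ∑[ k < m +ℕ n ] (sign m k * sign m k) ≈⟨ sum-cong (m +ℕ n) (sign-*-sign m) ⟩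
    ∑[ k < m +ℕ n ] 1#                    ≈⟨ sum-const (m +ℕ n) 1# ⟩
    natR R (m +ℕ n) * 1#                  ≈⟨ *-identityʳ _ ⟩
    natR R (m +ℕ n)                       ∎

  sum-sign-*-sign-*-inverse : ∀ m u → natR R m * u ≈ 1# → ∑[ k < m +ℕ m ] (sign m k * sign m k) * u ≈ 1# + 1#
  sum-sign-*-sign-*-inverse m u mu≈1 = begin
    ∑[ k < m +ℕ m ] (sign m k * sign m k) * u ≈⟨ *-congʳ (trans (sum-sign-*-sign m m) (natR-+ m m)) ⟩
    (natR R m + natR R m) * u                 ≈⟨ distribʳ u _ _ ⟩
    natR R m * u + natR R m * u               ≈⟨ +-cong mu≈1 mu≈1 ⟩
    1# + 1#                                   ∎

  Q≈householder : ∀ m u i j → Q R m u i j ≈ householder (m +ℕ m) u (sign m) i j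
  Q≈householder m u i j with side m i | side m j
  ... | left a  | left b  rewrite splitAt-↑ˡ m a m | splitAt-↑ˡ m b m =
    +-cong (reflexive (≡.sym (Id-injective (_↑ˡ m) (↑ˡ-injective m _ _) a b)))
           (-‿cong (sym (trans (*-identityˡ _) (*-identityʳ u))))
  ... | left a  | right b rewrite splitAt-↑ˡ m a m | splitAt-↑ʳ m m b = begin
    u                          ≈⟨ -‿involutive u ⟨
    - - u                      ≈⟨ +-identityˡ _ ⟨
    0# - - u                   ≈⟨ +-cong (reflexive (Id-offDiagonal (↑ˡ≢↑ʳ a b)))
                                         (-‿cong (trans (*-identityˡ _) (x*-1≈-x u))) ⟨
    Id R (m +ℕ m) (a ↑ˡ m) (m ↑ʳ b) - 1# * (u * - 1#) ∎
  ... | right a | left b  rewrite splitAt-↑ʳ m m a | splitAt-↑ˡ m b m = begin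
    u                          ≈⟨ -‿involutive u ⟨
    - - u                      ≈⟨ +-identityˡ _ ⟨
    0# - - u                   ≈⟨ +-cong (reflexive (Id-offDiagonal (↑ˡ≢↑ʳ b a ∘ ≡.sym)))
                                         (-‿cong (trans (-1*x≈-x _) (-‿cong (*-identityʳ u)))) ⟨
    Id R (m +ℕ m) (m ↑ʳ a) (b ↑ˡ m) - - 1# * (u * 1#) ∎
  ... | right a | right b rewrite splitAt-↑ʳ m m a | splitAt-↑ʳ m m b =
    +-cong (reflexive (≡.sym (Id-injective (m ↑ʳ_) (↑ʳ-injective m _ _) a b)))
           (-‿cong (sym (trans (-1*x≈-x _) (trans (-‿cong (x*-1≈-x u)) (-‿involutive u)))))

  sign-central : ∀ m {n} (k : Fin (m +ℕ n)) x → sign m k * x ≈ x * sign m k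
  sign-central m k x with side m k
  ... | left a  = trans (*-congʳ (reflexive (sign-↑ˡ m a)))
                        (trans (*-identityˡ x) (trans (sym (*-identityʳ x)) (*-congˡ (reflexive (≡.sym (sign-↑ˡ m a))))))
  ... | right b = trans (*-congʳ (reflexive (sign-↑ʳ m b)))
                        (trans (-1*x≈-x x) (trans (sym (x*-1≈-x x)) (*-congˡ (reflexive (≡.sym (sign-↑ʳ m b))))))

  swapped-difference : ∀ m (f g : Fin (m +ℕ m) → Carrier) x y →
    (∀ a → f (a ↑ˡ m) ≈ x) → (∀ a → g (a ↑ˡ m) ≈ y) →
    (∀ b → f (m ↑ʳ b) ≈ y) → (∀ b → g (m ↑ʳ b) ≈ x) →
    ∀ k → f k - g k ≈ sign m k * (x - y)
  swapped-difference m f g x y fˡ gˡ fʳ gʳ k with side m k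
  ... | left a  = begin
    f (a ↑ˡ m) - g (a ↑ˡ m)    ≈⟨ +-cong (fˡ a) (-‿cong (gˡ a)) ⟩
    x - y                      ≈⟨ *-identityˡ _ ⟨
    1# * (x - y)               ≡⟨ ≡.cong (_* (x - y)) (sign-↑ˡ m a) ⟨
    sign m (a ↑ˡ m) * (x - y)  ∎
  ... | right b = begin
    f (m ↑ʳ b) - g (m ↑ʳ b)    ≈⟨ +-cong (fʳ b) (-‿cong (gʳ b)) ⟩
    y - x                      ≈⟨ ⁻¹-anti-homo‿- x y ⟨
    - (x - y)                  ≈⟨ -1*x≈-x _ ⟨
    - 1# * (x - y)             ≡⟨ ≡.cong (_* (x - y)) (sign-↑ʳ m b) ⟨
    sign m (m ↑ʳ b) * (x - y)  ∎

  rowSum-colSum : ∀ {n m} (B : Mat R n m) r s → RowSum R B r → ColSum R B s → natR R n * r ≈ natR R m * s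
  rowSum-colSum {n} {m} B r s rows cols = begin
    natR R n * r                   ≈⟨ sum-const n r ⟨
    ∑[ i < n ] r                   ≈⟨ sum-cong n (λ i → trans (reflexive (≡.sym (ΣF≡sum m (B i)))) (rows i)) ⟨
    ∑[ i < n ] ∑[ j < m ] B i j    ≈⟨ ∑-comm B ⟩
    ∑[ j < m ] ∑[ i < n ] B i j    ≈⟨ sum-cong m (λ j → trans (reflexive (≡.sym (ΣF≡sum n (λ i → B i j)))) (cols j)) ⟩
    ∑[ j < m ] s                   ≈⟨ sum-const m s ⟩
    natR R m * s                   ∎

  inverse-transfer : ∀ n m {u v ρ κ} → u * natR R n ≈ 1# → natR R m * v ≈ 1# →
                     natR R n * ρ ≈ natR R m * κ → ρ * v ≈ u * κ
  inverse-transfer n m {u} {v} {ρ} {κ} un≈1 mv≈1 nρ≈mκ = begin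
    ρ * v                      ≈⟨ *-identityˡ _ ⟨
    1# * (ρ * v)               ≈⟨ *-congʳ un≈1 ⟨
    u * natR R n * (ρ * v)     ≈⟨ *-assoc _ _ _ ⟩
    u * (natR R n * (ρ * v))   ≈⟨ *-congˡ (*-assoc _ _ _) ⟨
    u * (natR R n * ρ * v)     ≈⟨ *-congˡ (*-congʳ nρ≈mκ) ⟩
    u * (natR R m * κ * v)     ≈⟨ *-congˡ (*-congʳ (natR-central m κ)) ⟩
    u * (κ * natR R m * v)     ≈⟨ *-congˡ (*-assoc _ _ _) ⟩
    u * (κ * (natR R m * v))   ≈⟨ *-congˡ (*-congˡ mv≈1) ⟩
    u * (κ * 1#)               ≈⟨ *-congˡ (*-identityʳ κ) ⟩
    u * κ                      ∎

  outer-cancel : ∀ {n m} (s : Fin n → Carrier) (t : Fin m → Carrier) a x ρ T u →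
                 ρ * u ≈ x → T * u ≈ 1# + 1# → ∀ i j →
                 a - outer s x t i j - outer s ((ρ - x * T) * u) t i j ≈ a
  outer-cancel s t a x ρ T u ρu≈x Tu≈2 i j = begin
    a - outer s x t i j - outer s ((ρ - x * T) * u) t i j
      ≈⟨ +-congˡ (-‿cong (*-congˡ (*-congʳ coefficient))) ⟩
    a - outer s x t i j - s i * (- x * t j)
      ≈⟨ +-congˡ (-‿cong (trans (*-congˡ (sym (-‿distribˡ-* x (t j)))) (sym (-‿distribʳ-* (s i) _)))) ⟩
    a - outer s x t i j - - outer s x t i j
      ≈⟨ +-congˡ (-‿involutive _) ⟩
    a - outer s x t i j + outer s x t i j
      ≈⟨ +-assoc _ _ _ ⟩
    a + (- outer s x t i j + outer s x t i j)
      ≈⟨ +-congˡ (-‿inverseˡ _) ⟩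
    a + 0#
      ≈⟨ +-identityʳ a ⟩
    a ∎
    where
    coefficient : (ρ - x * T) * u ≈ - x
    coefficient = begin
      (ρ - x * T) * u       ≈⟨ [y-z]x≈yx-zx u ρ _ ⟩
      ρ * u - x * T * u     ≈⟨ +-cong ρu≈x (-‿cong (trans (*-assoc x T u) (*-congˡ Tu≈2))) ⟩
      x - x * (1# + 1#)     ≈⟨ +-congˡ (-‿cong (trans (distribˡ x 1# 1#) (+-cong (*-identityʳ x) (*-identityʳ x)))) ⟩
      x - (x + x)           ≈⟨ +-congˡ (-‿+-comm x x) ⟨
      x + (- x + - x)       ≈⟨ +-assoc x (- x) (- x) ⟨
      x - x - x             ≈⟨ +-congʳ (-‿inverseʳ x) ⟩
      0# - x                ≈⟨ +-identityˡ _ ⟩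
      - x                   ∎

  module _ (ni nj : ℕ) (A : Mat R (ni +ℕ ni) (nj +ℕ nj)) where

    block-colBalance : ∀ c₁ c₂ →
      ColSum R (blk₁₁ R ni nj A) c₁ → ColSum R (blk₂₂ R ni nj A) c₁ →
      ColSum R (blk₁₂ R ni nj A) c₂ → ColSum R (blk₂₁ R ni nj A) c₂ →
      ∀ j → (sign ni ᵥ· A) j ≈ (c₁ - c₂) * sign nj j
    block-colBalance c₁ c₂ C₁₁ C₂₂ C₁₂ C₂₁ j = begin
      (sign ni ᵥ· A) j        ≈⟨ sum-sign-* ni ni (λ k → A k j) ⟩
      topSum j - bottomSum j  ≈⟨ swapped-difference nj topSum bottomSum c₁ c₂
                                   (asSum C₁₁) (asSum C₂₁) (asSum C₁₂) (asSum C₂₂) j ⟩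
      sign nj j * (c₁ - c₂)   ≈⟨ sign-central nj j _ ⟩
      (c₁ - c₂) * sign nj j   ∎
      where
      topSum bottomSum : Fin (nj +ℕ nj) → Carrier
      topSum    j = ∑[ a < ni ] A (a ↑ˡ ni) j
      bottomSum j = ∑[ a < ni ] A (ni ↑ʳ a) j
      asSum : ∀ {m} {B : Mat R ni m} {c} → ColSum R B c → ∀ b → ∑[ a < ni ] B a b ≈ c
      asSum {B = B} cols b = trans (reflexive (≡.sym (ΣF≡sum ni (λ a → B a b)))) (cols b)

    block-rowBalance : ∀ r₁ r₂ →
      RowSum R (blk₁₁ R ni nj A) r₁ → RowSum R (blk₂₂ R ni nj A) r₁ →
      RowSum R (blk₁₂ R ni nj A) r₂ → RowSum R (blk₂₁ R ni nj A) r₂ →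
      ∀ i → (A ·ᵥ sign nj) i ≈ sign ni i * (r₁ - r₂)
    block-rowBalance r₁ r₂ R₁₁ R₂₂ R₁₂ R₂₁ i = begin
      (A ·ᵥ sign nj) i        ≈⟨ sum-*-sign nj nj (A i) ⟩
      leftSum i - rightSum i  ≈⟨ swapped-difference ni leftSum rightSum r₁ r₂
                                   (asSum R₁₁) (asSum R₁₂) (asSum R₂₁) (asSum R₂₂) i ⟩
      sign ni i * (r₁ - r₂)   ∎
      where
      leftSum rightSum : Fin (ni +ℕ ni) → Carrier
      leftSum  i = ∑[ b < nj ] A i (b ↑ˡ nj)
      rightSum i = ∑[ b < nj ] A i (nj ↑ʳ b)
      asSum : ∀ {n} {B : Mat R n nj} {r} → RowSum R B r → ∀ a → ∑[ b < nj ] B a b ≈ r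
      asSum {B = B} rows a = trans (reflexive (≡.sym (ΣF≡sum nj (B a)))) (rows a)

    block-doubleCounting : ∀ r₁ r₂ c₁ c₂ →
      RowSum R (blk₁₁ R ni nj A) r₁ → ColSum R (blk₁₁ R ni nj A) c₁ →
      RowSum R (blk₁₂ R ni nj A) r₂ → ColSum R (blk₁₂ R ni nj A) c₂ →
      natR R ni * (r₁ - r₂) ≈ natR R nj * (c₁ - c₂)
    block-doubleCounting r₁ r₂ c₁ c₂ R₁₁ C₁₁ R₁₂ C₁₂ = begin
      natR R ni * (r₁ - r₂)            ≈⟨ x[y-z]≈xy-xz _ _ _ ⟩
      natR R ni * r₁ - natR R ni * r₂  ≈⟨ +-cong (rowSum-colSum _ r₁ c₁ R₁₁ C₁₁) (-‿cong (rowSum-colSum _ r₂ c₂ R₁₂ C₁₂)) ⟩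
      natR R nj * c₁ - natR R nj * c₂  ≈⟨ x[y-z]≈xy-xz _ _ _ ⟨
      natR R nj * (c₁ - c₂)            ∎

lemma3p4 : ∀ {c ℓ} (R : Ring c ℓ) →
    let open Ring R in
    (ni nj : ℕ) → 1 ≤ ni → 1 ≤ nj →
    (ui uj : Carrier) → IsCentralInv R ni ui → IsCentralInv R nj uj →
    (A : Mat R (ni +ℕ ni) (nj +ℕ nj)) →
    (r₁ c₁ r₂ c₂ : Carrier) →
    RowSum R (blk₁₁ R ni nj A) r₁ → RowSum R (blk₂₂ R ni nj A) r₁ →
    ColSum R (blk₁₁ R ni nj A) c₁ → ColSum R (blk₂₂ R ni nj A) c₁ →
    RowSum R (blk₁₂ R ni nj A) r₂ → RowSum R (blk₂₁ R ni nj A) r₂ →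
    ColSum R (blk₁₂ R ni nj A) c₂ → ColSum R (blk₂₁ R ni nj A) c₂ →
    ∀ i j → _⊗_ R (_⊗_ R (Q R ni ui) A) (Q R nj uj) i j ≈ A i j
lemma3p4 R ni nj _ _ ui uj (_ , uini≈1 , _) (njuj≈1 , _) A r₁ c₁ r₂ c₂ R₁₁ R₂₂ C₁₁ C₂₂ R₁₂ R₂₁ C₁₂ C₂₁ i j =
  begin
    _⊗_ R (_⊗_ R (Q R ni ui) A) (Q R nj uj) i j
      ≈⟨ ⊗-cong R (⊗-cong R (Q≈householder R ni ui) (λ _ _ → refl)) (Q≈householder R nj uj) i j ⟩
    _⊗_ R (_⊗_ R (householder R _ ui s) A) (householder R _ uj t) i j
      ≈⟨ householder-sandwich R A s t ui uj κ ρ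
           (block-colBalance R ni nj A c₁ c₂ C₁₁ C₂₂ C₁₂ C₂₁) (block-rowBalance R ni nj A r₁ r₂ R₁₁ R₂₂ R₁₂ R₂₁) i j ⟩
    A i j - outer R s (ui * κ) t i j - outer R s ((ρ - ui * κ * ∑[ k < _ ] (t k * t k)) * uj) t i j
      ≈⟨ outer-cancel R s t (A i j) (ui * κ) ρ _ uj
           (inverse-transfer R ni nj uini≈1 njuj≈1 (block-doubleCounting R ni nj A r₁ r₂ c₁ c₂ R₁₁ C₁₁ R₁₂ C₁₂))
           (sum-sign-*-sign-*-inverse R nj uj njuj≈1) i j ⟩
    A i j
  ∎
  where
  open Ring R
  open SemiringSum semiring using (sum-syntax)
  open SetoidReasoning setoid
  κ = c₁ - c₂
  ρ = r₁ - r₂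
  s = sign R ni
  t = sign R nj
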